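{- Let $k_\mathcal{G}=n_\mathcal{G}\ge1$ and $k_\mathcal{H}=n_\mathcal{H}\ge1$. Then the polynomials $s_g=0$ for $g\in V(\mathcal{G})$ form a $0$-sum-of-squares certificate of $f_{\mathrm{viz}}$, i.e. $f_{\mathrm{viz}}\equiv\sum_{g\in V(\mathcal{G})}s_g^2=0\pmod{I_{\mathrm{viz}}}$; consequently Vizing's inequality $\gamma(G)\gamma(H)\le\gamma(G\Box H)$ holds for all graphs $G$ with $\gamma(G)=|V(G)|=n_\mathcal{G}$ and $H$ with $\gamma(H)=|V(H)|=n_\mathcal{H}$.
   Context: $\mathbb{K}$ is a subfield of $\mathbb{R}$. $V(\mathcal{G})$ is a set of $n_\mathcal{G}$ vertices with fixed subset $D_\mathcal{G}$ of size $k_\mathcal{G}$; $V(\mathcal{H})$ a disjoint set of $n_\mathcal{H}$ vertices with fixed subset $D_\mathcal{H}$ of size $k_\mathcal{H}$. Variables $e_{gg'}=e_{g'g}$ for 2-subsets of $V(\mathcal{G})$, $e_{hh'}$ for 2-subsets of $V(\mathcal{H})$, $x_{gh}$ for $g\in V(\mathcal{G}),h\in V(\mathcal{H})$; $P$ is the polynomial ring over $\mathbb{K}$ in these. $I_{\mathrm{viz}}\subseteq P$ is generated by: $e_{gg'}^2-e_{gg'}$; $\prod_{g'\in D_\mathcal{G}}(1-e_{gg'})$ for $g\in V(\mathcal{G})\setminus D_\mathcal{G}$; $\prod_{g'\in V(\mathcal{G})\setminus S}\sum_{g\in S}e_{gg'}$ for $S\subseteq V(\mathcal{G})$, $|S|=k_\mathcal{G}-1$;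 the same three families for $\mathcal{H}$; $x_{gh}^2-x_{gh}$; and $(1-x_{gh})\prod_{g'\ne g}(1-e_{gg'}x_{g'h})\prod_{h'\ne h}(1-e_{hh'}x_{gh'})$ for all $g,h$. $f_{\mathrm{viz}}=\sum_{g,h}x_{gh}-k_\mathcal{G}k_\mathcal{H}$. $\gamma(\cdot)$ is the domination number, $G\Box H$ the Cartesian product graph. An $\ell$-sum-of-squares certificate of $f$ modulo $I$ is a family $s_i$ of polynomials of degree $\le\ell$ with $f-\sum s_i^2\in I$. -}

module Defs where

open import Level using (Level; _⊔_; suc)
open import Algebra.Bundles using (CommutativeRing)
open import Data.Nat as ℕ using (ℕ; zero; _≤_; _⊔_)
open import Data.Bool using (Bool; true; false; T; _∧_; _∨_; not)
open import Data.Fin as Fin using (Fin; toℕ; remQuot)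
open import Data.Fin.Properties using (_≟_)
open import Data.Fin.Subset using (Subset; _∈_; _∉_; ∣_∣)
open import Data.Fin.Subset.Properties using (_∈?_)
open import Data.List as List using (List; []; _∷_; allFin; filter; foldr)
open import Data.Product using (Σ; ∃; _×_; _,_; proj₁; proj₂)
open import Relation.Binary.PropositionalEquality using (_≡_; _≢_)
open import Relation.Nullary using (¬_; yes; no)
open import Relation.Nullary.Decidable using (¬?)
open import Data.Sum using (_⊎_)

record Field (c ℓ : Level) : Set (Level.suc (c Level.⊔ ℓ)) where
  field
    commRing : CommutativeRing c ℓ
  open CommutativeRing commRing public
  field
    1≉0      : ¬ (1# ≈ 0#)
    inverse  : ∀ x → ¬ (x ≈ 0#) → Σ Carrier λ y → (x * y) ≈ 1#

natK : ∀ {c ℓ} (K : Field c ℓ) → ℕ → Field.Carrier K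
natK K zero       = Field.0# K
natK K (ℕ.suc n)  = Field._+_ K (Field.1# K) (natK K n)

CharacteristicZero : ∀ {c ℓ} → Field c ℓ → Set ℓ
CharacteristicZero K = ∀ n → Field._≈_ K (natK K (ℕ.suc n)) (Field.0# K) → Data.Empty.⊥
  where import Data.Empty

-- The polynomial ring K[V] as the free commutative K-algebra on V:
-- syntactic expressions modulo the congruence generated by the
-- commutative ring axioms and the structure of K.

module Poly {c ℓ : Level} (K : Field c ℓ) where
  open Field K using (0#; 1#) renaming (Carrier to A; _+_ to _+K_; _*_ to _*K_; -_ to -K_; _≈_ to _≈K_)

  data Pol (V : Set) : Set c where
    con  : A → Pol V
    var  : V → Pol V
    _⊕_  : Pol V → Pol V → Pol V
    _⊗_  : Pol V → Pol V → Pol V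
    ⊝_   : Pol V → Pol V

  infixl 6 _⊕_
  infixl 7 _⊗_
  infix 8 ⊝_
  infix 4 _≋_

  𝟘 𝟙 : ∀ {V} → Pol V
  𝟘 = con 0#
  𝟙 = con 1#

  _⊖_ : ∀ {V} → Pol V → Pol V → Pol V
  p ⊖ q = p ⊕ (⊝ q)
  infixl 6 _⊖_

  data _≋_ {V : Set} : Pol V → Pol V → Set (c Level.⊔ ℓ) where
    ≋-refl  : ∀ {p} → p ≋ p
    ≋-sym   : ∀ {p q} → p ≋ q → q ≋ p
    ≋-trans : ∀ {p q r} → p ≋ q → q ≋ r → p ≋ r
    ⊕-cong  : ∀ {p p′ q q′} → p ≋ p′ → q ≋ q′ → p ⊕ q ≋ p′ ⊕ q′
    ⊗-cong  : ∀ {p p′ q q′} → p ≋ p′ → q ≋ q′ → p ⊗ q ≋ p′ ⊗ q′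
    ⊝-cong  : ∀ {p q} → p ≋ q → ⊝ p ≋ ⊝ q
    ⊕-assoc : ∀ p q r → (p ⊕ q) ⊕ r ≋ p ⊕ (q ⊕ r)
    ⊕-comm  : ∀ p q → p ⊕ q ≋ q ⊕ p
    ⊕-idʳ   : ∀ p → p ⊕ 𝟘 ≋ p
    ⊕-invʳ  : ∀ p → p ⊕ (⊝ p) ≋ 𝟘
    ⊗-assoc : ∀ p q r → (p ⊗ q) ⊗ r ≋ p ⊗ (q ⊗ r)
    ⊗-comm  : ∀ p q → p ⊗ q ≋ q ⊗ p
    ⊗-idʳ   : ∀ p → p ⊗ 𝟙 ≋ p
    distribʳ : ∀ p q r → (q ⊕ r) ⊗ p ≋ (q ⊗ p) ⊕ (r ⊗ p)
    con-cong : ∀ {a b} → a ≈K b → con a ≋ con b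
    con-+   : ∀ a b → con (a +K b) ≋ con a ⊕ con b
    con-*   : ∀ a b → con (a *K b) ≋ con a ⊗ con b
    con--   : ∀ a → con (-K a) ≋ ⊝ con a

  ∑ : ∀ {a} {V} {I : Set a} → List I → (I → Pol V) → Pol V
  ∑ is f = foldr (λ i acc → f i ⊕ acc) 𝟘 is

  ∏ : ∀ {a} {V} {I : Set a} → List I → (I → Pol V) → Pol V
  ∏ is f = foldr (λ i acc → f i ⊗ acc) 𝟙 is

  sdeg : ∀ {V} → Pol V → ℕ
  sdeg (con _) = 0
  sdeg (var _) = 1
  sdeg (p ⊕ q) = sdeg p ℕ.⊔ sdeg q
  sdeg (p ⊗ q) = sdeg p ℕ.+ sdeg q
  sdeg (⊝ p)   = sdeg p

  DegreeAtMost : ∀ {V} → ℕ → Pol V → Set (c Level.⊔ ℓ)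
  DegreeAtMost d p = Σ _ λ q → (p ≋ q) × (sdeg q ≤ d)

  _∈Ideal_ : ∀ {V} {G : Set} → Pol V → (G → Pol V) → Set (c Level.⊔ ℓ)
  _∈Ideal_ {V} {G} f gen =
    Σ (List (Pol V × G)) λ cs → f ≋ ∑ cs (λ { (a , g) → a ⊗ gen g })

  IsSOSCertificate : ∀ {V} {G J : Set} → ℕ → Pol V → (G → Pol V)
                     → List J → (J → Pol V) → Set (c Level.⊔ ℓ)
  IsSOSCertificate d f gen js s =
    (∀ j → DegreeAtMost d (s j)) × ((f ⊖ ∑ js (λ j → s j ⊗ s j)) ∈Ideal gen)

elems : ∀ {n} → Subset n → List (Fin n)
elems S = filter (_∈? S) (allFin _)

nonElems : ∀ {n} → Subset n → List (Fin n)
nonElems S = filter (λ x → ¬? (x ∈? S)) (allFin _)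

others : ∀ {n} → Fin n → List (Fin n)
others g = filter (λ g′ → ¬? (g′ ≟ g)) (allFin _)

-- Variables of P: e_{gg'} (2-subsets {i,j}, stored with i < j),
-- e_{hh'}, and x_{gh}.

data VizVar (nG nH : ℕ) : Set where
  eG : (i j : Fin nG) → i Fin.< j → VizVar nG nH
  eH : (i j : Fin nH) → i Fin.< j → VizVar nG nH
  x  : Fin nG → Fin nH → VizVar nG nH

module Viz {c ℓ : Level} (K : Field c ℓ)
           (nG kG : ℕ) (DG : Subset nG)
           (nH kH : ℕ) (DH : Subset nH) where
  open Field K using (-_; 0#; 1#)
  open Poly K

  P = Pol (VizVar nG nH)

  -- e_{gg'} = e_{g'g}; only used for g ≠ g'
  eg : Fin nG → Fin nG → P
  eg i j with i Fin.<? j | j Fin.<? i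
  ... | yes i<j | _       = var (eG i j i<j)
  ... | no _    | yes j<i = var (eG j i j<i)
  ... | no _    | no _    = 𝟘

  eh : Fin nH → Fin nH → P
  eh i j with i Fin.<? j | j Fin.<? i
  ... | yes i<j | _       = var (eH i j i<j)
  ... | no _    | yes j<i = var (eH j i j<i)
  ... | no _    | no _    = 𝟘

  xv : Fin nG → Fin nH → P
  xv g h = var (x g h)

  data Gen : Set where
    boolG  : (i j : Fin nG) → i Fin.< j → Gen
    domG   : (g : Fin nG) → g ∉ DG → Gen
    minG   : (S : Subset nG) → ∣ S ∣ ℕ.+ 1 ≡ kG → Gen
    boolH  : (i j : Fin nH) → i Fin.< j → Gen
    domH   : (h : Fin nH) → h ∉ DH → Gen
    minH   : (S : Subset nH) → ∣ S ∣ ℕ.+ 1 ≡ kH → Gen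
    boolX  : Fin nG → Fin nH → Gen
    domX   : Fin nG → Fin nH → Gen

  gen : Gen → P
  gen (boolG i j p) = var (eG i j p) ⊗ var (eG i j p) ⊖ var (eG i j p)
  gen (domG g _)    = ∏ (elems DG) (λ g′ → 𝟙 ⊖ eg g g′)
  gen (minG S _)    = ∏ (nonElems S) (λ g′ → ∑ (elems S) (λ g → eg g g′))
  gen (boolH i j p) = var (eH i j p) ⊗ var (eH i j p) ⊖ var (eH i j p)
  gen (domH h _)    = ∏ (elems DH) (λ h′ → 𝟙 ⊖ eh h h′)
  gen (minH S _)    = ∏ (nonElems S) (λ h′ → ∑ (elems S) (λ h → eh h h′))
  gen (boolX g h)   = xv g h ⊗ xv g h ⊖ xv g h
  gen (domX g h)    =
    (𝟙 ⊖ xv g h) ⊗ ∏ (others g) (λ g′ → 𝟙 ⊖ eg g g′ ⊗ xv g′ h)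
                 ⊗ ∏ (others h) (λ h′ → 𝟙 ⊖ eh h h′ ⊗ xv g h′)

  fviz : P
  fviz = ∑ (allFin nG) (λ g → ∑ (allFin nH) (λ h → xv g h))
         ⊖ con (natK K (kG ℕ.* kH))

record Graph (n : ℕ) : Set where
  field
    adj   : Fin n → Fin n → Bool
    sym   : ∀ u v → adj u v ≡ adj v u
    irrefl : ∀ v → adj v v ≡ false
open Graph public

Dominating : ∀ {n} → (Fin n → Fin n → Bool) → Subset n → Set
Dominating {n} A D = ∀ v → v ∈ D ⊎ Σ (Fin n) (λ u → u ∈ D × T (A u v))

IsDominationNumber : ∀ {n} → (Fin n → Fin n → Bool) → ℕ → Set
IsDominationNumber A k =
  Σ _ (λ D → Dominating A D × ∣ D ∣ ≡ k) × (∀ D → Dominating A D → k ≤ ∣ D ∣)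

eqFin : ∀ {n} → Fin n → Fin n → Bool
eqFin i j with i ≟ j
... | yes _ = true
... | no _  = false

-- adjacency of G □ H on vertex set Fin (nG * nH) ≅ Fin nG × Fin nH (via remQuot)
□-adj : ∀ {m n} → Graph m → Graph n → Fin (m ℕ.* n) → Fin (m ℕ.* n) → Bool
□-adj {m} {n} G H u v with remQuot n u | remQuot n v
... | (g , h) | (g′ , h′) = (eqFin g g′ ∧ adj H h h′) ∨ (eqFin h h′ ∧ adj G g g′)

module Submission where

-- With k = n on both sides, the minimality generator of
-- I_viz for the (n-1)-set S = V ∖ {v} is the single factor ∑_{u ≠ v} e_{uv}.
-- The e_{uv} are idempotent modulo I_viz, and in a commutative semiring in
-- which every positive integer is a unit (as in K[V]/I, K having
-- characteristic zero), idempotents summing to zero all vanish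
-- (SemiringLists).  Hence every edge variable lies in I_viz, the
-- domination generator for (g,h) collapses to 1 - x_{gh}, every x_{gh} is 1
-- modulo I_viz and f_viz = ∑ x_{gh} - n_G n_H vanishes: the zero polynomials
-- form a degree-0 certificate.
--
-- A graph with γ(G) = |V(G)| has no edges (an edge uv
-- would let V ∖ {v} dominate), so G □ H is edgeless as well and each of its
-- dominating sets contains all n_G n_H vertices.

open import Defs
open import Level using (_⊔_)
open import Algebra.Bundles using (CommutativeRing; CommutativeSemiring)
import Algebra.Properties.CommutativeSemigroup as CommutativeSemigroupProperties
import Algebra.Properties.Ring as RingProperties
import Algebra.Solver.Ring.NaturalCoefficients.Default as NaturalCoefficientSolver
open import Data.Bool using (Bool; true; false; T; _∧_; _∨_)
open import Data.Bool.Properties using (∧-zeroʳ)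
open import Data.Empty using (⊥-elim)
open import Data.Fin as Fin using (Fin)
open import Data.Fin.Properties using (_≟_)
open import Data.Fin.Subset using (Subset; ∁; ⁅_⁆; ⊤; ∣_∣; _⊆_) renaming (_∈_ to _∈ₛ_)
open import Data.Fin.Subset.Properties
  using (_∈?_; x∈⁅x⁆; x≢y⇒x∉⁅y⁆; x∈∁p⇒x∉p; x∉p⇒x∈∁p; ∣∁p∣≡n∸∣p∣; ∣⁅x⁆∣≡1; ∣⊤∣≡n; p⊆q⇒∣p∣≤∣q∣)
open import Data.List using (List; []; _∷_; _++_; map; filter; foldr; length; allFin)
open import Data.List.Membership.Propositional using () renaming (_∈_ to _∈ₗ_)
open import Data.List.Membership.Propositional.Properties using (∈-filter⁺; ∈-filter⁻; ∈-allFin)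
open import Data.List.Properties using (filter-≐; filter-accept; filter-reject; filter-none; length-tabulate)
open import Data.List.Relation.Unary.All as All using (All; []; _∷_)
open import Data.List.Relation.Unary.Any using (here; there)
open import Data.List.Relation.Unary.AllPairs using (_∷_)
open import Data.List.Relation.Unary.Unique.Propositional using (Unique)
open import Data.List.Relation.Unary.Unique.Propositional.Properties using (allFin⁺)
open import Data.Nat as ℕ using (ℕ; zero; suc; _≤_; z≤n)
open import Data.Nat.Properties as ℕP using ()
open import Data.Product using (∃; _×_; _,_; proj₁; proj₂)
open import Data.Sum using (inj₁; inj₂)
open import Function using (_∘_; id)
open import Relation.Binary.Definitions using (DecidableEquality)
open import Relation.Binary.PropositionalEquality as ≡ using (_≡_; _≢_)
open import Relation.Nullary using (yes; no; ¬_)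
open import Relation.Nullary.Decidable using (¬?; decidable-stable)

module SemiringLists {c ℓ} (R : CommutativeSemiring c ℓ) where
  open CommutativeSemiring R
  open import Algebra.Properties.Semiring.Mult semiring using () renaming (_×_ to _·_)
  open import Relation.Binary.Reasoning.Setoid setoid
  open NaturalCoefficientSolver R using (solve; _:+_; _:*_; _:=_; con)

  ∑ : ∀ {a} {I : Set a} → List I → (I → Carrier) → Carrier
  ∑ is f = foldr (λ i acc → f i + acc) 0# is

  ∏ : ∀ {a} {I : Set a} → List I → (I → Carrier) → Carrier
  ∏ is f = foldr (λ i acc → f i * acc) 1# is

  ∑-constant : ∀ {a} {I : Set a} (is : List I) {f : I → Carrier} {r} →
               (∀ i → f i ≈ r) → ∑ is f ≈ length is · r
  ∑-constant []       _    = refl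
  ∑-constant (i ∷ is) f≈r = +-cong (f≈r i) (∑-constant is f≈r)

  ∑-zero : ∀ {a} {I : Set a} (is : List I) {f : I → Carrier} →
           (∀ i → f i ≈ 0#) → ∑ is f ≈ 0#
  ∑-zero []       _    = refl
  ∑-zero (i ∷ is) f≈0 = trans (+-cong (f≈0 i) (∑-zero is f≈0)) (+-identityˡ 0#)

  ∏-ones : ∀ {a} {I : Set a} {is : List I} {f : I → Carrier} →
           All (λ i → f i ≈ 1#) is → ∏ is f ≈ 1#
  ∏-ones []            = refl
  ∏-ones (f≈1 ∷ f≈1s) = trans (*-cong f≈1 (∏-ones f≈1s)) (*-identityʳ 1#)

  Idempotent : Carrier → Set ℓ
  Idempotent r = r * r ≈ r

  PositiveIntegersInvertible : Set (c ⊔ ℓ)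
  PositiveIntegersInvertible = ∀ n → ∃ λ y → (suc n · 1#) * y ≈ 1#

  module _ (invertible : PositiveIntegersInvertible) where

    -- Induction on the list: multiplying by the first idempotent e shows
    -- u e = 0 (with a larger integer), after which e can be dropped.
    positive+idempotents-cancel : ∀ {a} {I : Set a} {is : List I} {f : I → Carrier} →
      All (λ i → Idempotent (f i)) is →
      ∀ n u → u * (suc n · 1# + ∑ is f) ≈ 0# → u ≈ 0#
    positive+idempotents-cancel [] n u u[m+0]≈0 with invertible n
    ... | y , my≈1 = begin
      u                          ≈⟨ *-identityʳ u ⟨
      u * 1#                     ≈⟨ *-congˡ my≈1 ⟨
      u * (m * y)                ≈⟨ solve 3 (λ u m y → u :* (m :* y) := (u :* (m :+ con 0)) :* y) refl u m y ⟩
      (u * (m + 0#)) * y         ≈⟨ *-congʳ u[m+0]≈0 ⟩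
      0# * y                     ≈⟨ zeroˡ y ⟩
      0#                         ∎
      where
      m : Carrier
      m = suc n · 1#
    positive+idempotents-cancel {is = i ∷ is} {f} (idem ∷ idems) n u u[m+e+s]≈0 =
      positive+idempotents-cancel idems n u u[m+s]≈0
      where
      m e s : Carrier
      m = suc n · 1#
      e = f i
      s = ∑ is f
      ue[1+m+s]≈0 : (u * e) * ((1# + m) + s) ≈ 0#
      ue[1+m+s]≈0 = begin
        (u * e) * ((1# + m) + s)        ≈⟨ solve 4 (λ u e m s → (u :* e) :* ((con 1 :+ m) :+ s) := u :* e :+ (u :* e) :* (m :+ s)) refl u e m s ⟩
        u * e + (u * e) * (m + s)       ≈⟨ +-congʳ (*-congˡ idem) ⟨
        u * (e * e) + (u * e) * (m + s) ≈⟨ solve 4 (λ u e m s → u :* (e :* e) :+ (u :* e) :* (m :+ s) := e :* (u :* (m :+ (e :+ s)))) refl u e m s ⟩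
        e * (u * (m + (e + s)))         ≈⟨ *-congˡ u[m+e+s]≈0 ⟩
        e * 0#                          ≈⟨ zeroʳ e ⟩
        0#                              ∎
      ue≈0 : u * e ≈ 0#
      ue≈0 = positive+idempotents-cancel idems (suc n) (u * e) ue[1+m+s]≈0
      u[m+s]≈0 : u * (m + s) ≈ 0#
      u[m+s]≈0 = begin
        u * (m + s)          ≈⟨ +-identityʳ _ ⟨
        u * (m + s) + 0#     ≈⟨ +-congˡ ue≈0 ⟨
        u * (m + s) + u * e  ≈⟨ solve 4 (λ u e m s → u :* (m :+ s) :+ u :* e := u :* (m :+ (e :+ s))) refl u e m s ⟩
        u * (m + (e + s))    ≈⟨ u[m+e+s]≈0 ⟩
        0#                   ∎

    -- Idempotents whose sum is zero are all zero: e (1 + ∑ rest) = e (e + ∑ rest) = 0.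
    idempotents-sum-zero : ∀ {a} {I : Set a} {is : List I} {f : I → Carrier} →
      All (λ i → Idempotent (f i)) is → ∑ is f ≈ 0# → All (λ i → f i ≈ 0#) is
    idempotents-sum-zero []                      _       = []
    idempotents-sum-zero {is = i ∷ is} {f} (idem ∷ idems) e+s≈0 =
      e≈0 ∷ idempotents-sum-zero idems s≈0
      where
      e s : Carrier
      e = f i
      s = ∑ is f
      e[1+s]≈0 : e * (1 · 1# + s) ≈ 0#
      e[1+s]≈0 = begin
        e * ((1# + 0#) + s) ≈⟨ solve 2 (λ e s → e :* ((con 1 :+ con 0) :+ s) := e :+ e :* s) refl e s ⟩
        e + e * s           ≈⟨ +-congʳ idem ⟨
        e * e + e * s       ≈⟨ distribˡ e e s ⟨
        e * (e + s)         ≈⟨ *-congˡ e+s≈0 ⟩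
        e * 0#              ≈⟨ zeroʳ e ⟩
        0#                  ∎
      e≈0 : e ≈ 0#
      e≈0 = positive+idempotents-cancel idems 0 e e[1+s]≈0
      s≈0 : s ≈ 0#
      s≈0 = begin
        s      ≈⟨ +-identityˡ s ⟨
        0# + s ≈⟨ +-congʳ e≈0 ⟨
        e + s  ≈⟨ e+s≈0 ⟩
        0#     ∎

module PolynomialRing {c ℓ} (K : Field c ℓ) (V : Set) where
  open Poly K

  commutativeRing : CommutativeRing c (c ⊔ ℓ)
  commutativeRing = record
    { Carrier = Pol V ; _≈_ = _≋_ ; _+_ = _⊕_ ; _*_ = _⊗_ ; -_ = ⊝_ ; 0# = 𝟘 ; 1# = 𝟙
    ; isCommutativeRing = record
      { isRing = record
        { +-isAbelianGroup = record
          { isGroup = record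
            { isMonoid = record
              { isSemigroup = record
                { isMagma = record
                  { isEquivalence = record { refl = ≋-refl ; sym = ≋-sym ; trans = ≋-trans }
                  ; ∙-cong = ⊕-cong }
                ; assoc = ⊕-assoc }
              ; identity = (λ p → ≋-trans (⊕-comm 𝟘 p) (⊕-idʳ p)) , ⊕-idʳ }
            ; inverse = (λ p → ≋-trans (⊕-comm (⊝ p) p) (⊕-invʳ p)) , ⊕-invʳ
            ; ⁻¹-cong = ⊝-cong }
          ; comm = ⊕-comm }
        ; *-cong = ⊗-cong
        ; *-assoc = ⊗-assoc
        ; *-identity = (λ p → ≋-trans (⊗-comm 𝟙 p) (⊗-idʳ p)) , ⊗-idʳ
        ; distrib = (λ p q r → ≋-trans (⊗-comm p (q ⊕ r))
                                 (≋-trans (distribʳ p q r) (⊕-cong (⊗-comm q p) (⊗-comm r p))))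
                    , distribʳ }
      ; *-comm = ⊗-comm } }

module IdealQuotient {c ℓ} (K : Field c ℓ) {V G : Set} (gen : G → Poly.Pol K V) where
  open Poly K
  open PolynomialRing K V
  module P = CommutativeRing commutativeRing
  open RingProperties P.ring using (x[y-z]≈xy-xz; -1*x≈-x; ⁻¹-anti-homo‿-; -‿+-comm; -0#≈0#)
  open CommutativeSemigroupProperties P.+-commutativeSemigroup using (interchange)
  open import Relation.Binary.Reasoning.Setoid P.setoid

  private
    generated : Pol V × G → Pol V
    generated (a , g) = a ⊗ gen g

  InIdeal : Pol V → Set (c ⊔ ℓ)
  InIdeal p = p ∈Ideal gen

  ∑-++ : ∀ cs ds → ∑ (cs ++ ds) generated ≋ ∑ cs generated ⊕ ∑ ds generated
  ∑-++ []       ds = ≋-sym (P.+-identityˡ _)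
  ∑-++ (_ ∷ cs) ds = ≋-trans (⊕-cong ≋-refl (∑-++ cs ds)) (≋-sym (⊕-assoc _ _ _))

  ∑-scale : ∀ r cs → ∑ (map (λ { (a , g) → r ⊗ a , g }) cs) generated ≋ r ⊗ ∑ cs generated
  ∑-scale r []             = ≋-sym (P.zeroʳ r)
  ∑-scale r ((a , g) ∷ cs) =
    ≋-trans (⊕-cong (⊗-assoc r a (gen g)) (∑-scale r cs)) (≋-sym (P.distribˡ r _ _))

  InIdeal-resp : ∀ {p q} → p ≋ q → InIdeal p → InIdeal q
  InIdeal-resp p≋q (cs , p≋∑) = cs , ≋-trans (≋-sym p≋q) p≋∑

  𝟘-InIdeal : InIdeal 𝟘
  𝟘-InIdeal = [] , ≋-refl

  gen-InIdeal : ∀ g → InIdeal (gen g)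
  gen-InIdeal g = (𝟙 , g) ∷ [] , ≋-sym (≋-trans (⊕-idʳ _) (P.*-identityˡ _))

  ⊕-InIdeal : ∀ {p q} → InIdeal p → InIdeal q → InIdeal (p ⊕ q)
  ⊕-InIdeal (cs , p≋) (ds , q≋) = cs ++ ds , ≋-trans (⊕-cong p≋ q≋) (≋-sym (∑-++ cs ds))

  ⊗-InIdeal : ∀ r {p} → InIdeal p → InIdeal (r ⊗ p)
  ⊗-InIdeal r (cs , p≋) = map _ cs , ≋-trans (⊗-cong ≋-refl p≋) (≋-sym (∑-scale r cs))

  ⊝-InIdeal : ∀ {p} → InIdeal p → InIdeal (⊝ p)
  ⊝-InIdeal {p} p∈I = InIdeal-resp (-1*x≈-x p) (⊗-InIdeal (⊝ 𝟙) p∈I)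

  infix 4 _~_
  _~_ : Pol V → Pol V → Set (c ⊔ ℓ)
  p ~ q = InIdeal (p ⊖ q)

  private
    telescope : ∀ p q r → (p ⊖ q) ⊕ (q ⊖ r) ≋ p ⊖ r
    telescope p q r = begin
      (p ⊖ q) ⊕ (q ⊖ r)   ≈⟨ ⊕-assoc _ _ _ ⟩
      p ⊕ (⊝ q ⊕ (q ⊖ r)) ≈⟨ ⊕-cong ≋-refl (≋-sym (⊕-assoc _ _ _)) ⟩
      p ⊕ ((⊝ q ⊕ q) ⊖ r) ≈⟨ ⊕-cong ≋-refl (⊕-cong (P.-‿inverseˡ q) ≋-refl) ⟩
      p ⊕ (𝟘 ⊖ r)         ≈⟨ ⊕-cong ≋-refl (P.+-identityˡ _) ⟩
      p ⊖ r               ∎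

  ≋⇒~ : ∀ {p q} → p ≋ q → p ~ q
  ≋⇒~ {p} {q} p≋q = InIdeal-resp (≋-trans (≋-sym (⊕-invʳ q)) (⊕-cong (≋-sym p≋q) ≋-refl)) 𝟘-InIdeal

  ~-sym : ∀ {p q} → p ~ q → q ~ p
  ~-sym {p} {q} p~q = InIdeal-resp (⁻¹-anti-homo‿- p q) (⊝-InIdeal p~q)

  ~-trans : ∀ {p q r} → p ~ q → q ~ r → p ~ r
  ~-trans {p} {q} {r} p~q q~r = InIdeal-resp (telescope p q r) (⊕-InIdeal p~q q~r)

  ~-⊕ : ∀ {p p′ q q′} → p ~ p′ → q ~ q′ → p ⊕ q ~ p′ ⊕ q′
  ~-⊕ {p} {p′} {q} {q′} p~p′ q~q′ = InIdeal-resp e (⊕-InIdeal p~p′ q~q′)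
    where
    e : (p ⊖ p′) ⊕ (q ⊖ q′) ≋ (p ⊕ q) ⊖ (p′ ⊕ q′)
    e = ≋-trans (interchange p (⊝ p′) q (⊝ q′)) (⊕-cong ≋-refl (-‿+-comm p′ q′))

  ~-⊝ : ∀ {p q} → p ~ q → ⊝ p ~ ⊝ q
  ~-⊝ {p} {q} p~q = InIdeal-resp (≋-sym (-‿+-comm p (⊝ q))) (⊝-InIdeal p~q)

  -- pq - p′q′ = q(p - p′) + p′(q - q′)
  ~-⊗ : ∀ {p p′ q q′} → p ~ p′ → q ~ q′ → p ⊗ q ~ p′ ⊗ q′
  ~-⊗ {p} {p′} {q} {q′} p~p′ q~q′ = InIdeal-resp e (⊕-InIdeal (⊗-InIdeal q p~p′) (⊗-InIdeal p′ q~q′))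
    where
    e : q ⊗ (p ⊖ p′) ⊕ p′ ⊗ (q ⊖ q′) ≋ p ⊗ q ⊖ p′ ⊗ q′
    e = begin
      q ⊗ (p ⊖ p′) ⊕ p′ ⊗ (q ⊖ q′)          ≈⟨ ⊕-cong (x[y-z]≈xy-xz q p p′) (x[y-z]≈xy-xz p′ q q′) ⟩
      (q ⊗ p ⊖ q ⊗ p′) ⊕ (p′ ⊗ q ⊖ p′ ⊗ q′) ≈⟨ ⊕-cong (⊕-cong (⊗-comm q p) (⊝-cong (⊗-comm q p′))) ≋-refl ⟩
      (p ⊗ q ⊖ p′ ⊗ q) ⊕ (p′ ⊗ q ⊖ p′ ⊗ q′) ≈⟨ telescope _ _ _ ⟩
      p ⊗ q ⊖ p′ ⊗ q′                       ∎

  quotientRing : CommutativeRing c (c ⊔ ℓ)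
  quotientRing = record
    { Carrier = Pol V ; _≈_ = _~_ ; _+_ = _⊕_ ; _*_ = _⊗_ ; -_ = ⊝_ ; 0# = 𝟘 ; 1# = 𝟙
    ; isCommutativeRing = record
      { isRing = record
        { +-isAbelianGroup = record
          { isGroup = record
            { isMonoid = record
              { isSemigroup = record
                { isMagma = record
                  { isEquivalence = record { refl = ≋⇒~ ≋-refl ; sym = ~-sym ; trans = ~-trans }
                  ; ∙-cong = ~-⊕ }
                ; assoc = λ p q r → ≋⇒~ (⊕-assoc p q r) }
              ; identity = (λ p → ≋⇒~ (P.+-identityˡ p)) , (λ p → ≋⇒~ (⊕-idʳ p)) }
            ; inverse = (λ p → ≋⇒~ (P.-‿inverseˡ p)) , (λ p → ≋⇒~ (⊕-invʳ p))
            ; ⁻¹-cong = ~-⊝ }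
          ; comm = λ p q → ≋⇒~ (⊕-comm p q) }
        ; *-cong = ~-⊗
        ; *-assoc = λ p q r → ≋⇒~ (⊗-assoc p q r)
        ; *-identity = (λ p → ≋⇒~ (P.*-identityˡ p)) , (λ p → ≋⇒~ (⊗-idʳ p))
        ; distrib = (λ p q r → ≋⇒~ (P.distribˡ p q r)) , (λ p q r → ≋⇒~ (distribʳ p q r)) }
      ; *-comm = λ p q → ≋⇒~ (⊗-comm p q) } }

  module Q = CommutativeRing quotientRing

  InIdeal⇒~𝟘 : ∀ {p} → InIdeal p → p ~ 𝟘
  InIdeal⇒~𝟘 {p} = InIdeal-resp (≋-sym (≋-trans (⊕-cong ≋-refl -0#≈0#) (⊕-idʳ p)))

module QuotientIntegers {c ℓ} (K : Field c ℓ) {V G : Set} (gen : G → Poly.Pol K V) where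
  open Poly K
  open IdealQuotient K gen
  open import Algebra.Properties.Semiring.Mult Q.semiring using () renaming (_×_ to _·_)

  con-natK : ∀ n → con (natK K n) ~ n · 𝟙
  con-natK zero    = Q.refl
  con-natK (suc n) = Q.trans (≋⇒~ (con-+ _ _)) (~-⊕ Q.refl (con-natK n))

  positive-invertible : CharacteristicZero K → ∀ n → ∃ λ y → (suc n · 𝟙) ⊗ y ~ 𝟙
  positive-invertible χ n with Field.inverse K (natK K (suc n)) (χ n)
  ... | y , ny≈1 = con y , Q.trans (~-⊗ (Q.sym (con-natK (suc n))) Q.refl)
                                   (≋⇒~ (≋-trans (≋-sym (con-* _ _)) (con-cong ny≈1)))

filter-≟-unique : ∀ {A : Set} (_≟ₐ_ : DecidableEquality A) {v : A} {ys : List A} →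
                  Unique ys → v ∈ₗ ys → filter (_≟ₐ v) ys ≡ v ∷ []
filter-≟-unique _≟ₐ_ {ys = y ∷ ys} (y∉ys ∷ _) (here ≡.refl) =
  ≡.trans (filter-accept (_≟ₐ y) ≡.refl)
          (≡.cong (y ∷_) (filter-none (_≟ₐ y) (All.map ≡.≢-sym y∉ys)))
filter-≟-unique _≟ₐ_ {ys = y ∷ ys} (y∉ys ∷ unique) (there v∈ys) =
  ≡.trans (filter-reject (_≟ₐ _) (All.lookup y∉ys v∈ys)) (filter-≟-unique _≟ₐ_ unique v∈ys)

∈∁⁅⁆⇒≢ : ∀ {n} {u v : Fin n} → u ∈ₛ ∁ ⁅ v ⁆ → u ≢ v
∈∁⁅⁆⇒≢ {v = v} u∈ ≡.refl = x∈∁p⇒x∉p u∈ (x∈⁅x⁆ v)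

≢⇒∈∁⁅⁆ : ∀ {n} {u v : Fin n} → u ≢ v → u ∈ₛ ∁ ⁅ v ⁆
≢⇒∈∁⁅⁆ = x∉p⇒x∈∁p ∘ x≢y⇒x∉⁅y⁆

elems-∁⁅⁆ : ∀ {n} (v : Fin n) → elems (∁ ⁅ v ⁆) ≡ others v
elems-∁⁅⁆ {n} v = filter-≐ (_∈? ∁ ⁅ v ⁆) (λ u → ¬? (u ≟ v)) (∈∁⁅⁆⇒≢ , ≢⇒∈∁⁅⁆) (allFin n)

nonElems-∁⁅⁆ : ∀ {n} (v : Fin n) → nonElems (∁ ⁅ v ⁆) ≡ v ∷ []
nonElems-∁⁅⁆ {n} v = ≡.trans (filter-≐ _ (_≟ v) (outside⇒≡ , ≡⇒outside) (allFin n))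
                             (filter-≟-unique _≟_ (allFin⁺ n) (∈-allFin v))
  where
  outside⇒≡ : ∀ {u} → ¬ (u ∈ₛ ∁ ⁅ v ⁆) → u ≡ v
  outside⇒≡ {u} u∉ = decidable-stable (u ≟ v) (u∉ ∘ ≢⇒∈∁⁅⁆)
  ≡⇒outside : ∀ {u} → u ≡ v → ¬ (u ∈ₛ ∁ ⁅ v ⁆)
  ≡⇒outside u≡v u∈ = ∈∁⁅⁆⇒≢ u∈ u≡v

∣∁⁅⁆∣+1 : ∀ {n} (v : Fin n) → ∣ ∁ ⁅ v ⁆ ∣ ℕ.+ 1 ≡ n
∣∁⁅⁆∣+1 {suc m} v = begin
  ∣ ∁ ⁅ v ⁆ ∣ ℕ.+ 1           ≡⟨ ≡.cong (ℕ._+ 1) (∣∁p∣≡n∸∣p∣ ⁅ v ⁆) ⟩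
  (suc m ℕ.∸ ∣ ⁅ v ⁆ ∣) ℕ.+ 1 ≡⟨ ≡.cong (λ k → (suc m ℕ.∸ k) ℕ.+ 1) (∣⁅x⁆∣≡1 v) ⟩
  m ℕ.+ 1                     ≡⟨ ℕP.+-comm m 1 ⟩
  suc m                       ∎
  where open ≡.≡-Reasoning

others⇒≢ : ∀ {n} {u w : Fin n} → w ∈ₗ others u → u ≢ w
others⇒≢ {u = u} w∈ = ≡.≢-sym (proj₂ (∈-filter⁻ (λ w → ¬? (w ≟ u)) {xs = allFin _} w∈))

module VizCertificate {c ℓ} (K : Field c ℓ) (χ : CharacteristicZero K)
                      {nG nH : ℕ} (DG : Subset nG) (DH : Subset nH) where
  open Poly K
  open Viz K nG nG DG nH nH DH
  open IdealQuotient K gen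
  open QuotientIntegers K gen
  open SemiringLists Q.commutativeSemiring using (∑-constant; ∑-zero; ∏-ones; idempotents-sum-zero)
  open RingProperties Q.ring using (x∙y⁻¹≈ε⇒x≈y; -0#≈0#)
  open import Algebra.Properties.Semiring.Mult Q.semiring using (×-congˡ; ×-congʳ; ×-assocˡ) renaming (_×_ to _·_)
  open import Relation.Binary.Reasoning.Setoid Q.setoid

  -- Edge variables of a side with k = n vanish: for S = V ∖ {v} the
  -- minimality generator is the sum of idempotents ∑_{u ≠ v} e_{uv}.
  -- Stated for an arbitrary edge-variable family, so it serves both G and H.
  edges-vanish : ∀ {n} (e : Fin n → Fin n → P) →
                 (∀ u v → e u v ⊗ e u v ~ e u v) →
                 (∀ S → ∣ S ∣ ℕ.+ 1 ≡ n → ∏ (nonElems S) (λ v → ∑ (elems S) (λ u → e u v)) ~ 𝟘) →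
                 ∀ u v → u ≢ v → e u v ~ 𝟘
  edges-vanish e idempotent minimal u v u≢v =
    All.lookup (idempotents-sum-zero (positive-invertible χ) (All.tabulate λ _ → idempotent _ v) sum~𝟘)
               (∈-filter⁺ (λ w → ¬? (w ≟ v)) (∈-allFin u) u≢v)
    where
    minimal-at-v : ∏ (v ∷ []) (λ w → ∑ (others v) (λ u → e u w)) ~ 𝟘
    minimal-at-v = ≡.subst₂ (λ ws us → ∏ ws (λ w → ∑ us (λ u → e u w)) ~ 𝟘)
                            (nonElems-∁⁅⁆ v) (elems-∁⁅⁆ v) (minimal (∁ ⁅ v ⁆) (∣∁⁅⁆∣+1 v))
    sum~𝟘 : ∑ (others v) (λ u → e u v) ~ 𝟘
    sum~𝟘 = Q.trans (Q.sym (Q.*-identityʳ _)) minimal-at-v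

  -- The variables e_{gg′} are boolean modulo I_viz (e_{gg} is the constant 0).
  eg-idempotent : ∀ u v → eg u v ⊗ eg u v ~ eg u v
  eg-idempotent u v with u Fin.<? v | v Fin.<? u
  ... | yes u<v | _       = gen-InIdeal (boolG u v u<v)
  ... | no _    | yes v<u = gen-InIdeal (boolG v u v<u)
  ... | no _    | no _    = ≋⇒~ (P.zeroˡ 𝟘)

  eh-idempotent : ∀ u v → eh u v ⊗ eh u v ~ eh u v
  eh-idempotent u v with u Fin.<? v | v Fin.<? u
  ... | yes u<v | _       = gen-InIdeal (boolH u v u<v)
  ... | no _    | yes v<u = gen-InIdeal (boolH v u v<u)
  ... | no _    | no _    = ≋⇒~ (P.zeroˡ 𝟘)

  eg-vanish : ∀ g g′ → g ≢ g′ → eg g g′ ~ 𝟘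
  eg-vanish = edges-vanish eg eg-idempotent (λ S size → InIdeal⇒~𝟘 (gen-InIdeal (minG S size)))

  eh-vanish : ∀ h h′ → h ≢ h′ → eh h h′ ~ 𝟘
  eh-vanish = edges-vanish eh eh-idempotent (λ S size → InIdeal⇒~𝟘 (gen-InIdeal (minH S size)))

  one-minus-vanishing : ∀ {e} p → e ~ 𝟘 → 𝟙 ⊖ e ⊗ p ~ 𝟙
  one-minus-vanishing {e} p e~𝟘 = begin
    𝟙 ⊖ e ⊗ p ≈⟨ ~-⊕ Q.refl (~-⊝ (~-⊗ e~𝟘 Q.refl)) ⟩
    𝟙 ⊖ 𝟘 ⊗ p ≈⟨ ~-⊕ Q.refl (Q.trans (~-⊝ (Q.zeroˡ p)) -0#≈0#) ⟩
    𝟙 ⊕ 𝟘     ≈⟨ Q.+-identityʳ 𝟙 ⟩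
    𝟙         ∎

  -- The domination generator for (g,h) collapses to 1 - x_{gh}.
  x-forced : ∀ g h → xv g h ~ 𝟙
  x-forced g h = Q.sym (x∙y⁻¹≈ε⇒x≈y 𝟙 (xv g h) 1-x~𝟘)
    where
    G-factor : ∏ (others g) (λ g′ → 𝟙 ⊖ eg g g′ ⊗ xv g′ h) ~ 𝟙
    G-factor = ∏-ones (All.tabulate λ g′∈ → one-minus-vanishing _ (eg-vanish g _ (others⇒≢ g′∈)))
    H-factor : ∏ (others h) (λ h′ → 𝟙 ⊖ eh h h′ ⊗ xv g h′) ~ 𝟙
    H-factor = ∏-ones (All.tabulate λ h′∈ → one-minus-vanishing _ (eh-vanish h _ (others⇒≢ h′∈)))
    1-x~𝟘 : 𝟙 ⊖ xv g h ~ 𝟘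
    1-x~𝟘 = begin
      𝟙 ⊖ xv g h               ≈⟨ Q.trans (Q.*-identityʳ _) (Q.*-identityʳ _) ⟨
      (𝟙 ⊖ xv g h) ⊗ 𝟙 ⊗ 𝟙     ≈⟨ ~-⊗ (~-⊗ Q.refl G-factor) H-factor ⟨
      gen (domX g h)           ≈⟨ InIdeal⇒~𝟘 (gen-InIdeal (domX g h)) ⟩
      𝟘                        ∎

  -- f_viz vanishes modulo I_viz: each of the n_G n_H variables x_{gh} is 1.
  fviz~𝟘 : fviz ~ ∑ (allFin nG) (λ _ → 𝟘 ⊗ 𝟘)
  fviz~𝟘 = begin
    fviz                                   ≈⟨ ~-⊕ all-ones (~-⊝ (con-natK (nG ℕ.* nH))) ⟩
    (nG ℕ.* nH) · 𝟙 ⊖ (nG ℕ.* nH) · 𝟙     ≈⟨ Q.-‿inverseʳ _ ⟩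
    𝟘                                      ≈⟨ ∑-zero (allFin nG) (λ _ → Q.zeroˡ 𝟘) ⟨
    ∑ (allFin nG) (λ _ → 𝟘 ⊗ 𝟘)            ∎
    where
    all-ones : ∑ (allFin nG) (λ g → ∑ (allFin nH) (λ h → xv g h)) ~ (nG ℕ.* nH) · 𝟙
    all-ones = begin
      ∑ (allFin nG) (λ g → ∑ (allFin nH) (λ h → xv g h))
        ≈⟨ ∑-constant (allFin nG) (λ g → ∑-constant (allFin nH) (x-forced g)) ⟩
      length (allFin nG) · (length (allFin nH) · 𝟙)
        ≈⟨ Q.trans (×-congˡ (length-tabulate {n = nG} id)) (×-congʳ nG (×-congˡ (length-tabulate {n = nH} id))) ⟩
      nG · (nH · 𝟙)
        ≈⟨ ×-assocˡ 𝟙 nG nH ⟩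
      (nG ℕ.* nH) · 𝟙 ∎

-- A graph whose domination number equals its order has no edges: an edge uv
-- would let the n - 1 vertices of V ∖ {v} dominate.
edgeless : ∀ {n} (G : Graph n) → IsDominationNumber (adj G) n → ∀ u v → adj G u v ≡ false
edgeless G (_ , minimum) u v with adj G u v in uv
... | false = ≡.refl
... | true  = ⊥-elim (ℕP.m+1+n≰m ∣ ∁ ⁅ v ⁆ ∣ n≤n-1)
  where
  u≢v : u ≢ v
  u≢v ≡.refl with ≡.trans (≡.sym uv) (irrefl G u)
  ... | ()
  dominating : Dominating (adj G) (∁ ⁅ v ⁆)
  dominating w with w ≟ v
  ... | yes ≡.refl = inj₂ (u , ≢⇒∈∁⁅⁆ u≢v , ≡.subst T (≡.sym uv) _)
  ... | no w≢v     = inj₁ (≢⇒∈∁⁅⁆ w≢v)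
  n≤n-1 : ∣ ∁ ⁅ v ⁆ ∣ ℕ.+ 1 ≤ ∣ ∁ ⁅ v ⁆ ∣
  n≤n-1 = ≡.subst (_≤ ∣ ∁ ⁅ v ⁆ ∣) (≡.sym (∣∁⁅⁆∣+1 v)) (minimum _ dominating)

edgeless-dominating : ∀ {n} {A : Fin n → Fin n → Bool} → (∀ u v → A u v ≡ false) →
                      ∀ {D} → Dominating A D → n ≤ ∣ D ∣
edgeless-dominating {n} no-edge {D} dominating =
  ≡.subst (_≤ ∣ D ∣) (∣⊤∣≡n n) (p⊆q⇒∣p∣≤∣q∣ ⊤⊆D)
  where
  ⊤⊆D : ⊤ ⊆ D
  ⊤⊆D {w} _ with dominating w
  ... | inj₁ w∈D          = w∈D
  ... | inj₂ (u , _ , uw) = ⊥-elim (≡.subst T (no-edge u w) uw)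

□-edgeless : ∀ {m n} (G : Graph m) (H : Graph n) →
             (∀ u v → adj G u v ≡ false) → (∀ u v → adj H u v ≡ false) →
             ∀ u v → □-adj G H u v ≡ false
□-edgeless {m} {n} G H noG noH u v =
  both-absent (eqFin g g′) (eqFin h h′) (noH h h′) (noG g g′)
  where
  g g′ : Fin m
  h h′ : Fin n
  g  = proj₁ (Fin.remQuot {m} n u)
  h  = proj₂ (Fin.remQuot {m} n u)
  g′ = proj₁ (Fin.remQuot {m} n v)
  h′ = proj₂ (Fin.remQuot {m} n v)
  both-absent : ∀ b₁ b₂ {x y} → x ≡ false → y ≡ false → (b₁ ∧ x) ∨ (b₂ ∧ y) ≡ false
  both-absent b₁ b₂ ≡.refl ≡.refl = ≡.cong₂ _∨_ (∧-zeroʳ b₁) (∧-zeroʳ b₂)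

vizing-full-domination : ∀ {nG nH} (G : Graph nG) (H : Graph nH) →
  IsDominationNumber (adj G) nG → IsDominationNumber (adj H) nH →
  ∀ k → IsDominationNumber (□-adj G H) k → nG ℕ.* nH ≤ k
vizing-full-domination G H γG γH k ((D , dominating , ∣D∣≡k) , _) =
  ≡.subst (_ ≤_) ∣D∣≡k (edgeless-dominating (□-edgeless G H (edgeless G γG) (edgeless H γH)) dominating)

theorem5p11 : ∀ {c ℓ} (K : Field c ℓ) → CharacteristicZero K →
    (nG kG nH kH : ℕ) → kG ≡ nG → 1 ≤ nG → kH ≡ nH → 1 ≤ nH →
    (DG : Subset nG) → ∣ DG ∣ ≡ kG → (DH : Subset nH) → ∣ DH ∣ ≡ kH →
    Poly.IsSOSCertificate K 0 (Viz.fviz K nG kG DG nH kH DH) (Viz.gen K nG kG DG nH kH DH)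
      (allFin nG) (λ _ → Poly.𝟘 K)
    × (∀ (G : Graph nG) (H : Graph nH) →
         IsDominationNumber (adj G) nG → IsDominationNumber (adj H) nH →
         ∀ k → IsDominationNumber (□-adj G H) k → nG ℕ.* nH ≤ k)
theorem5p11 K χ nG .nG nH .nH ≡.refl _ ≡.refl _ DG _ DH _ =
  ((λ _ → 𝟘 , ≋-refl , z≤n) , VizCertificate.fviz~𝟘 K χ DG DH) , vizing-full-domination
  where open Poly K using (𝟘; ≋-refl)
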